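{- Let $\phi$ be a CNF formula, let $(T,r,\gamma,\pi)$ be a project-join tree for $\phi$, and let $u_1,u_2$ be sibling nodes of $T$. Then $\Pi(u_1)\cap\mathrm{vars}(\Gamma(u_2))=\emptyset$.
   Context: A CNF formula is a set of clauses. In a rooted tree $(T,r)$, $C(v)$ denotes the children of $v$. Leaves are non-root nodes of degree one; the other nodes are internal. Siblings are distinct nodes with the same parent. A project-join tree for $\phi$ is $(T,r,\gamma,\pi)$ where: - $\gamma$ is a bijection from the leaves to the clauses of $\phi$; - $\pi$ maps internal nodes to subsets of $\mathrm{vars}(\phi)$; - $\{\pi(v)\}$ partitions $\mathrm{vars}(\phi)$, where some $\pi(v)$ may be empty; - for internal $v$, $x\in\pi(v)$ and any clause $c$ with $x\in\mathrm{vars}(c)$, the leaf $\gamma^{ -1}(c)$ is a descendant of $v$. Projection set: $\Pi(v)=\emptyset$ for a leaf, and $\Pi(v)=\pi(v)\cup\bigcup_{v'\in C(v)}\Pi(v')$ otherwise. Clause set: $\Gamma(v)=\{\gamma(v)\}$ for a leaf, and $\Gamma(v)=\bigcup_{v'\in C(v)}\Gamma(v')$ otherwise. For a set $S$ of clauses, $\mathrm{vars}(S)=\bigcup_{c\in S}\mathrm{vars}(c)$. -}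

module Defs where

open import Data.Nat using (ℕ; zero; suc)
open import Data.Bool using (Bool)
open import Data.Product using (_×_; proj₂; ∃₂)
open import Data.List using (List; []; _∷_; _++_; map; concatMap)
open import Data.Maybe using (Maybe; just; nothing)
open import Data.List.Membership.Propositional using (_∈_)
open import Data.List.Relation.Unary.Unique.Propositional using (Unique)
open import Data.List.Relation.Binary.Permutation.Propositional using (_↭_)
open import Relation.Binary.PropositionalEquality using (_≡_; _≢_)

-- Variables are natural numbers; a literal is (polarity , variable).
Var : Set
Var = ℕ

Literal : Set
Literal = Bool × Var

Clause : Set
Clause = List Literal

-- A CNF formula: a finite list of clauses (required duplicate-free, i.e. a set,
-- in the statement).
CNF : Set
CNF = List Clause

varsC : Clause → List Var
varsC c = map proj₂ c

varsS : List Clause → List Var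
varsS S = concatMap varsC S

-- A rooted tree whose leaves carry their clause (the labelling γ) and whose
-- internal nodes carry their projection set (the labelling π).
data Tree : Set where
  leaf : Clause → Tree
  node : List Var → List Tree → Tree

mutual
  Γ : Tree → List Clause
  Γ (leaf c) = c ∷ []
  Γ (node _ ts) = Γs ts

  Γs : List Tree → List Clause
  Γs [] = []
  Γs (t ∷ ts) = Γ t ++ Γs ts

mutual
  Π : Tree → List Var
  Π (leaf _) = []
  Π (node xs ts) = xs ++ Πs ts

  Πs : List Tree → List Var
  Πs [] = []
  Πs (t ∷ ts) = Π t ++ Πs ts

-- Nodes of a tree are identified by their position: the list of child indices
-- on the path from the root.
Path : Set
Path = List ℕ

mutual
  _at_ : Tree → Path → Maybe Tree
  t at [] = just t
  leaf _ at (i ∷ p) = nothing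
  node _ ts at (i ∷ p) = atL ts i p

  atL : List Tree → ℕ → Path → Maybe Tree
  atL [] _ _ = nothing
  atL (t ∷ ts) zero p = t at p
  atL (t ∷ ts) (suc i) p = atL ts i p

record IsProjectJoinTree (φ : CNF) (t : Tree) : Set where
  field
    root-internal : ∃₂ λ xs ts → t ≡ node xs ts
    nonroot-internal : ∀ q xs ts → q ≢ [] → t at q ≡ just (node xs ts) → ts ≢ []
    -- γ is a bijection from the leaves onto the clauses of φ
    γ-bijection : Γ t ↭ φ
    -- the sets π(v), v internal, partition vars(φ)
    π-disjoint : Unique (Π t)
    π-sound : ∀ x → x ∈ Π t → x ∈ varsS φ
    π-complete : ∀ x → x ∈ varsS φ → x ∈ Π t
    -- x ∈ π(v), x ∈ vars(c) implies leaf γ⁻¹(c) is a descendant of v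
    π-scope : ∀ q xs ts → t at q ≡ just (node xs ts) →
              ∀ x → x ∈ xs → ∀ c → c ∈ φ → x ∈ varsC c → c ∈ Γ (node xs ts)

{-# OPTIONS --safe #-}
module Submission where

-- A variable x ∈ Π(u₁) lies in π(v) for some node v below u₁. If x also occurs in a
-- clause c of Γ(u₂), the scope condition puts c into Γ(v) ⊆ Γ(u₁). But Γ of the root
-- lists every clause exactly once (it is a permutation of the duplicate-free φ), and
-- Γ(u₁), Γ(u₂) are disjoint pieces of Γ of their common parent; contradiction.

open import Defs
open import Data.Nat using (ℕ; zero; suc)
open import Data.List using (List; []; _∷_; _++_)
open import Data.Maybe using (just)
open import Data.Maybe.Properties using (just-injective)
open import Data.Product using (∃; ∃₂; _×_; _,_)
open import Data.Sum using (inj₁; inj₂)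
open import Function using (_∘_)
open import Relation.Binary.PropositionalEquality using (_≡_; _≢_; refl; sym; trans; cong; setoid)
open import Data.List.Membership.Propositional using (_∈_; find)
open import Data.List.Membership.Propositional.Properties
  using (∈-++⁻; ∈-++⁺ˡ; ∈-++⁺ʳ; ∈-concatMap⁻)
open import Data.List.Relation.Binary.Subset.Propositional using (_⊆_)
import Data.List.Relation.Unary.All as All
open import Data.List.Relation.Unary.All.Properties using (++⁻ˡ)
open import Data.List.Relation.Unary.Any using (here; there)
open import Data.List.Relation.Unary.Unique.Propositional using (Unique; []; _∷_)
open import Data.List.Relation.Binary.Disjoint.Propositional using (Disjoint)
open import Data.List.Relation.Binary.Permutation.Propositional using (↭-sym; ↭⇒↭ₛ)
open import Data.List.Relation.Binary.Permutation.Propositional.Properties using (∈-resp-↭)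
open import Data.List.Relation.Binary.Permutation.Setoid.Properties using (Unique-resp-↭)

Unique-++⁻ : {A : Set} {xs ys : List A} →
             Unique (xs ++ ys) → Unique xs × Unique ys × Disjoint xs ys
Unique-++⁻ {xs = []} u = [] , u , λ ()
Unique-++⁻ {xs = x ∷ xs} (x∉ ∷ u) =
  let uxs , uys , xs#ys = Unique-++⁻ u
      x∷xs#ys : Disjoint (x ∷ xs) _
      x∷xs#ys = λ where
        (here refl , y∈ys) → All.lookup x∉ (∈-++⁺ʳ xs y∈ys) refl
        (there y∈xs , y∈ys) → xs#ys (y∈xs , y∈ys)
  in ++⁻ˡ xs x∉ ∷ uxs , uys , x∷xs#ys

mutual
  at-++⁺ : ∀ t p q {s u} → t at p ≡ just s → s at q ≡ just u → t at (p ++ q) ≡ just u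
  at-++⁺ t [] q refl e = e
  at-++⁺ (node _ ts) (i ∷ p) q e e′ = atL-++⁺ ts i p q e e′

  atL-++⁺ : ∀ ts i p q {s u} → atL ts i p ≡ just s → s at q ≡ just u →
            atL ts i (p ++ q) ≡ just u
  atL-++⁺ (t ∷ ts) zero p q e e′ = at-++⁺ t p q e e′
  atL-++⁺ (t ∷ ts) (suc i) p q e e′ = atL-++⁺ ts i p q e e′

mutual
  at-++⁻ : ∀ t p q {u} → t at (p ++ q) ≡ just u → ∃ λ s → t at p ≡ just s × s at q ≡ just u
  at-++⁻ t [] q e = t , refl , e
  at-++⁻ (node _ ts) (i ∷ p) q e = atL-++⁻ ts i p q e

  atL-++⁻ : ∀ ts i p q {u} → atL ts i (p ++ q) ≡ just u →
            ∃ λ s → atL ts i p ≡ just s × s at q ≡ just u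
  atL-++⁻ (t ∷ ts) zero p q e = at-++⁻ t p q e
  atL-++⁻ (t ∷ ts) (suc i) p q e = atL-++⁻ ts i p q e

mutual
  ∈-Π⁻ : ∀ u {x} → x ∈ Π u → ∃₂ λ q xs → ∃ λ ts → u at q ≡ just (node xs ts) × x ∈ xs
  ∈-Π⁻ (node xs ts) x∈ with ∈-++⁻ xs x∈
  ... | inj₁ x∈xs = [] , xs , ts , refl , x∈xs
  ... | inj₂ x∈Πs = let i , q , rest = ∈-Πs⁻ ts x∈Πs in i ∷ q , rest

  ∈-Πs⁻ : ∀ ts {x} → x ∈ Πs ts →
          ∃₂ λ i q → ∃₂ λ xs us → atL ts i q ≡ just (node xs us) × x ∈ xs
  ∈-Πs⁻ (t ∷ ts) x∈ with ∈-++⁻ (Π t) x∈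
  ... | inj₁ x∈Πt = zero , ∈-Π⁻ t x∈Πt
  ... | inj₂ x∈Πs = let i , rest = ∈-Πs⁻ ts x∈Πs in suc i , rest

mutual
  Γ-⊆ : ∀ u q {s} → u at q ≡ just s → Γ s ⊆ Γ u
  Γ-⊆ u [] refl = λ c∈ → c∈
  Γ-⊆ (node _ ts) (i ∷ q) e = Γs-⊆ ts i q e

  Γs-⊆ : ∀ ts i q {s} → atL ts i q ≡ just s → Γ s ⊆ Γs ts
  Γs-⊆ (t ∷ ts) zero q e = ∈-++⁺ˡ ∘ Γ-⊆ t q e
  Γs-⊆ (t ∷ ts) (suc i) q e = ∈-++⁺ʳ (Γ t) ∘ Γs-⊆ ts i q e

mutual
  Γ-unique : ∀ u q {s} → Unique (Γ u) → u at q ≡ just s → Unique (Γ s)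
  Γ-unique u [] uΓ refl = uΓ
  Γ-unique (node _ ts) (i ∷ q) uΓ e = Γs-unique ts i q uΓ e

  Γs-unique : ∀ ts i q {s} → Unique (Γs ts) → atL ts i q ≡ just s → Unique (Γ s)
  Γs-unique (t ∷ ts) zero q uΓ e = let ut , _ = Unique-++⁻ uΓ in Γ-unique t q ut e
  Γs-unique (t ∷ ts) (suc i) q uΓ e = let _ , uts , _ = Unique-++⁻ uΓ in Γs-unique ts i q uts e

children-Γ-disjoint : ∀ ts {i j u₁ u₂} → Unique (Γs ts) → i ≢ j →
                      atL ts i [] ≡ just u₁ → atL ts j [] ≡ just u₂ → Disjoint (Γ u₁) (Γ u₂)
children-Γ-disjoint (t ∷ ts) {zero} {zero} _ i≢j _ _ = λ _ → i≢j refl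
children-Γ-disjoint (t ∷ ts) {zero} {suc j} uΓ _ refl e₂ (c∈t , c∈u₂) =
  let _ , _ , t#ts = Unique-++⁻ uΓ in t#ts (c∈t , Γs-⊆ ts j [] e₂ c∈u₂)
children-Γ-disjoint (t ∷ ts) {suc i} {zero} uΓ _ e₁ refl (c∈u₁ , c∈t) =
  let _ , _ , t#ts = Unique-++⁻ uΓ in t#ts (c∈t , Γs-⊆ ts i [] e₁ c∈u₁)
children-Γ-disjoint (t ∷ ts) {suc i} {suc j} uΓ i≢j e₁ e₂ =
  let _ , uts , _ = Unique-++⁻ uΓ in children-Γ-disjoint ts uts (i≢j ∘ cong suc) e₁ e₂

siblings-Γ-disjoint : ∀ t p {i j u₁ u₂} → Unique (Γ t) → i ≢ j →
                      t at (p ++ i ∷ []) ≡ just u₁ → t at (p ++ j ∷ []) ≡ just u₂ →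
                      Disjoint (Γ u₁) (Γ u₂)
siblings-Γ-disjoint t p {i} {j} uΓ i≢j e₁ e₂
  with at-++⁻ t p (i ∷ []) e₁ | at-++⁻ t p (j ∷ []) e₂
... | node xs ts , t∋s , e₁′ | s′ , t∋s′ , e₂′ with just-injective (trans (sym t∋s) t∋s′)
... | refl = children-Γ-disjoint ts (Γ-unique t p uΓ t∋s) i≢j e₁′ e₂′

lemma2 : (φ : CNF) → Unique φ → (t : Tree) → IsProjectJoinTree φ t →
         (p : Path) (i j : ℕ) → i ≢ j → (u₁ u₂ : Tree) →
         t at (p ++ i ∷ []) ≡ just u₁ → t at (p ++ j ∷ []) ≡ just u₂ →
         Disjoint (Π u₁) (varsS (Γ u₂))
lemma2 φ uφ t pjt p i j i≢j u₁ u₂ e₁ e₂ (x∈Πu₁ , x∈varsΓu₂) =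
  let q , xs , ts , u₁∋v , x∈xs = ∈-Π⁻ u₁ x∈Πu₁
      c , c∈Γu₂ , x∈c = find (∈-concatMap⁻ varsC {Γ u₂} x∈varsΓu₂)
      c∈φ = ∈-resp-↭ γ-bijection (Γ-⊆ t (p ++ j ∷ []) e₂ c∈Γu₂)
      t∋v = at-++⁺ t (p ++ i ∷ []) q e₁ u₁∋v
      c∈Γv = π-scope ((p ++ i ∷ []) ++ q) xs ts t∋v _ x∈xs c c∈φ x∈c
  in siblings-Γ-disjoint t p uΓ i≢j e₁ e₂ (Γ-⊆ u₁ q u₁∋v c∈Γv , c∈Γu₂)
  where
  open IsProjectJoinTree pjt
  uΓ : Unique (Γ t)
  uΓ = Unique-resp-↭ (setoid Clause) (↭⇒↭ₛ (↭-sym γ-bijection)) uφ
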